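{- Let $c_n := |A_n \setminus A_{n-1}|$ for $n \geq 0$. Then for all $n \geq 2$, \[ c_{n-1}^2 \leq c_n \leq c_{n-1}^2 \left( 1 + \frac{4}{c_{n-2}} \right); \] in particular $c_n = c_{n-1}^2(1 + O(1/c_{n-2}))$.
   Context: The adjunctive hierarchy of hereditarily finite sets is defined by $A_0 := \{\emptyset\}$ and $A_{n+1} := \{\emptyset\} \cup \{ x \cup \{y\} : x, y \in A_n\}$, with the convention $A_{ -1} := \emptyset$. -}

module Defs where

open import Data.Nat using (ℕ; zero; suc; _+_; _^_; _≟_)
open import Data.Nat.DivMod using (_%_; _/_)
open import Data.Bool using (if_then_else_)
open import Data.List using (List; []; _∷_; map; concatMap; filter; length; deduplicate)
open import Data.List.Membership.DecPropositional _≟_ using (_∈?_)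
open import Relation.Nullary using (¬?)
open import Relation.Nullary.Decidable using (⌊_⌋)

-- Hereditarily finite sets via the Ackermann coding:
-- a natural number x codes the HF set { y | bit y of x is 1 }.
-- This is a bijection ℕ ≅ HF, and code equality is set equality.

bit : ℕ → ℕ → ℕ
bit x zero    = x % 2
bit x (suc y) = bit (x / 2) y

emptyHF : ℕ
emptyHF = 0

adjoin : ℕ → ℕ → ℕ
adjoin x y = if ⌊ bit x y ≟ 1 ⌋ then x else x + 2 ^ y

-- A n, as a list of codes (possibly with repetitions)
-- A 0 = {∅},  A (n+1) = {∅} ∪ { x ∪ {y} : x, y ∈ A n }
A : ℕ → List ℕ
A zero    = emptyHF ∷ []
A (suc n) = emptyHF ∷ concatMap (λ x → map (adjoin x) (A n)) (A n)

-- A₋₁ convention: Aprev n = A (n - 1), with A (-1) = ∅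
Aprev : ℕ → List ℕ
Aprev zero    = []
Aprev (suc n) = A n

c : ℕ → ℕ
c n = length (deduplicate _≟_ (filter (λ z → ¬? (z ∈? Aprev n)) (A n)))

-- Write Nₙ = Aₙ \ Aₙ₋₁, so cₙ = |Nₙ|, and note that members of elements of Aₙ lie
-- in Aₙ₋₁. For x ∈ Aₙ and y ∈ Nₙ the set x ∪ {y} therefore lies in Nₙ₊₁, and y is
-- its only member outside Aₙ₋₁; so (x, y) ↦ x ∪ {y} is injective on Nₙ × Nₙ and
-- cₙ² ≤ cₙ₊₁. Conversely every element of Nₙ₊₁ is x ∪ {y} with x, y ∈ Aₙ not both
-- in Aₙ₋₁, so cₙ₊₁ ≤ cₙ² + 2cₙ|Aₙ₋₁|. By induction |Aₙ₋₁| ≤ |Aₙ₋₂| + cₙ₋₁ ≤ 2cₙ₋₁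
-- ≤ cₙ₋₁² ≤ cₙ (as cₘ ≥ 2 for m ≥ 2), hence |Aₘ| ≤ 2cₘ and cₘ|Aₘ| ≤ 2cₘ² ≤ 2cₘ₊₁;
-- multiplying the upper bound for cₙ by cₙ₋₂ now gives the second inequality.

{-# OPTIONS --safe #-}
module Submission where

open import Defs
open import Data.Nat using (ℕ; zero; suc; _+_; _*_; _^_; _∸_; _≤_; _≟_; s≤s; z≤n)
open import Data.Nat.Properties
open import Data.Nat.DivMod
open import Data.Nat.Divisibility using (m∣m*n; m%n≡0⇒n∣m)
open import Data.Nat.Tactic.RingSolver using (solve-∀)
open import Data.Product using (_×_; _,_; proj₁; proj₂; ∃₂; uncurry)
open import Data.Sum using (_⊎_; inj₁; inj₂)
open import Data.List using (List; []; _∷_; map; length; filter; deduplicate; cartesianProductWith; cartesianProduct; _++_; concatMap)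
open import Data.List.Properties using (length-map; length-++; length-removeAt′)
open import Data.List.Membership.Propositional using (_∈_; _∉_)
open import Data.List.Membership.Propositional.Properties
open import Data.List.Membership.DecPropositional _≟_ using (_∈?_)
open import Data.List.Relation.Binary.Subset.Propositional using (_⊆_)
open import Data.List.Relation.Unary.Any as Any using (here; there; index)
import Data.List.Relation.Unary.All as All
import Data.List.Relation.Unary.All.Properties as All
open import Data.List.Relation.Unary.Unique.Propositional using (Unique; []; _∷_)
open import Data.List.Relation.Unary.Unique.Propositional.Properties using (cartesianProduct⁺)
open import Data.List.Relation.Unary.Unique.DecPropositional.Properties _≟_ using (deduplicate-!)
open import Function using (_∘_)
open import Relation.Binary.PropositionalEquality
open import Relation.Nullary using (¬_; ¬?; yes; no; contradiction)

private
  variable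
    X Y Z : Set
    xs ys : List X

∈-─⁺ : ∀ {x z : X} (x∈ys : x ∈ ys) → z ∈ ys → z ≢ x → z ∈ (ys Any.─ x∈ys)
∈-─⁺ (here refl)  (here z≡x)   z≢x = contradiction z≡x z≢x
∈-─⁺ (here refl)  (there z∈ys) _   = z∈ys
∈-─⁺ (there x∈ys) (here z≡y)   _   = here z≡y
∈-─⁺ (there x∈ys) (there z∈ys) z≢x = there (∈-─⁺ x∈ys z∈ys z≢x)

length-mono-⊆ : Unique xs → xs ⊆ ys → length xs ≤ length ys
length-mono-⊆ {xs = []}               _            _     = z≤n
length-mono-⊆ {xs = x ∷ xs} {ys = ys} (x∉xs ∷ xs!) xs⊆ys = begin
  suc (length xs)              ≤⟨ s≤s (length-mono-⊆ xs! xs⊆ys─x) ⟩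
  suc (length (ys Any.─ x∈ys)) ≡⟨ length-removeAt′ ys (index x∈ys) ⟨
  length ys                    ∎
  where
  open ≤-Reasoning
  x∈ys : x ∈ ys
  x∈ys = xs⊆ys (here refl)

  xs⊆ys─x : xs ⊆ (ys Any.─ x∈ys)
  xs⊆ys─x z∈xs = ∈-─⁺ x∈ys (xs⊆ys (there z∈xs)) (λ z≡x → All.lookup x∉xs z∈xs (sym z≡x))

Unique-map⁺-on : ∀ (f : X → Y) → (∀ {a b} → a ∈ xs → b ∈ xs → f a ≡ f b → a ≡ b) →
                 Unique xs → Unique (map f xs)
Unique-map⁺-on f f-inj []           = []
Unique-map⁺-on f f-inj (x∉xs ∷ xs!) =
  All.map⁺ (All.tabulate λ y∈xs fx≡fy → All.lookup x∉xs y∈xs (f-inj (here refl) (there y∈xs) fx≡fy))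
  ∷ Unique-map⁺-on f (λ a∈xs b∈xs → f-inj (there a∈xs) (there b∈xs)) xs!

length-cartesianProductWith : ∀ (f : X → Y → Z) xs ys →
                              length (cartesianProductWith f xs ys) ≡ length xs * length ys
length-cartesianProductWith f []       ys = refl
length-cartesianProductWith f (x ∷ xs) ys = begin
  length (map (f x) ys ++ cartesianProductWith f xs ys)  ≡⟨ length-++ (map (f x) ys) ⟩
  length (map (f x) ys) + length (cartesianProductWith f xs ys)
    ≡⟨ cong₂ _+_ (length-map (f x) ys) (length-cartesianProductWith f xs ys) ⟩
  length ys + length xs * length ys                      ∎
  where open ≡-Reasoning

concatMap-map≡cartesianProductWith : ∀ (f : X → Y → Z) xs ys →
  concatMap (λ x → map (f x) ys) xs ≡ cartesianProductWith f xs ys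
concatMap-map≡cartesianProductWith f []       ys = refl
concatMap-map≡cartesianProductWith f (x ∷ xs) ys =
  cong (map (f x) ys ++_) (concatMap-map≡cartesianProductWith f xs ys)

card : List ℕ → ℕ
card xs = length (deduplicate _≟_ xs)

length≤card : {xs ys : List ℕ} → Unique xs → xs ⊆ ys → length xs ≤ card ys
length≤card xs! xs⊆ys = length-mono-⊆ xs! (∈-deduplicate⁺ _≟_ ∘ xs⊆ys)

card≤length : {xs ys : List ℕ} → xs ⊆ ys → card xs ≤ length ys
card≤length {xs} xs⊆ys = length-mono-⊆ (deduplicate-! xs) (xs⊆ys ∘ ∈-deduplicate⁻ _≟_ xs)

infix 4 _∈ₕ_ _∉ₕ_

_∈ₕ_ : ℕ → ℕ → Set
z ∈ₕ x = bit x z ≡ 1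

_∉ₕ_ : ℕ → ℕ → Set
z ∉ₕ x = ¬ z ∈ₕ x

∉ₕ-∅ : ∀ z → z ∉ₕ emptyHF
∉ₕ-∅ zero    ()
∉ₕ-∅ (suc z) = ∉ₕ-∅ z

∉ₕ⇒bit≡0 : ∀ x z → z ∉ₕ x → bit x z ≡ 0
∉ₕ⇒bit≡0 x zero z∉x with x % 2 | m%n<n x 2
... | 0           | _               = refl
... | 1           | _               = contradiction refl z∉x
... | suc (suc _) | s≤s (s≤s ())
∉ₕ⇒bit≡0 x (suc z) z∉x = ∉ₕ⇒bit≡0 (x / 2) z z∉x

even+1/2 : ∀ x → x % 2 ≡ 0 → (x + 1) / 2 ≡ x / 2
even+1/2 x x-even = trans (+-distrib-/-∣ˡ 1 (m%n≡0⇒n∣m x 2 x-even)) (+-identityʳ (x / 2))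

+2^suc/2 : ∀ x y → (x + 2 ^ suc y) / 2 ≡ x / 2 + 2 ^ y
+2^suc/2 x y = trans (+-distrib-/-∣ʳ x (m∣m*n (2 ^ y)))
                     (cong (x / 2 +_) (trans (cong (_/ 2) (*-comm 2 (2 ^ y))) (m*n/n≡m (2 ^ y) 2)))

bit-+2^-self : ∀ x y → bit x y ≡ 0 → bit (x + 2 ^ y) y ≡ 1
bit-+2^-self x zero    bit≡0 = %-remove-+ˡ 1 (m%n≡0⇒n∣m x 2 bit≡0)
bit-+2^-self x (suc y) bit≡0 =
  trans (cong (λ h → bit h y) (+2^suc/2 x y)) (bit-+2^-self (x / 2) y bit≡0)

bit-+2^-other : ∀ x y z → bit x y ≡ 0 → z ≢ y → bit (x + 2 ^ y) z ≡ bit x z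
bit-+2^-other x zero    zero    _     z≢y = contradiction refl z≢y
bit-+2^-other x zero    (suc z) bit≡0 _   = cong (λ h → bit h z) (even+1/2 x bit≡0)
bit-+2^-other x (suc y) zero    _     _   = %-remove-+ʳ x (m∣m*n (2 ^ y))
bit-+2^-other x (suc y) (suc z) bit≡0 z≢y =
  trans (cong (λ h → bit h z) (+2^suc/2 x y)) (bit-+2^-other (x / 2) y z bit≡0 (z≢y ∘ cong suc))

adjoin-∉ₕ : ∀ x y → y ∉ₕ x → adjoin x y ≡ x + 2 ^ y
adjoin-∉ₕ x y y∉x with bit x y ≟ 1
... | yes y∈x = contradiction y∈x y∉x
... | no  _   = refl

∈ₕ-adjoin-self : ∀ x y → y ∈ₕ adjoin x y
∈ₕ-adjoin-self x y with bit x y ≟ 1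
... | yes y∈x = y∈x
... | no  y∉x = bit-+2^-self x y (∉ₕ⇒bit≡0 x y y∉x)

∈ₕ-adjoin⁻ : ∀ {x y z} → z ∈ₕ adjoin x y → z ≡ y ⊎ z ∈ₕ x
∈ₕ-adjoin⁻ {x} {y} {z} z∈x∪y with bit x y ≟ 1 | z ≟ y
... | yes _  | _       = inj₂ z∈x∪y
... | no _   | yes z≡y = inj₁ z≡y
... | no y∉x | no z≢y  = inj₂ (trans (sym (bit-+2^-other x y z (∉ₕ⇒bit≡0 x y y∉x) z≢y)) z∈x∪y)

adjoin-injective : ∀ {x x′ y y′} → y ∉ₕ x → y ∉ₕ x′ → y′ ∉ₕ x →
                   adjoin x y ≡ adjoin x′ y′ → x ≡ x′ × y ≡ y′
adjoin-injective {x} {x′} {y} {y′} y∉x y∉x′ y′∉x eq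
  with ∈ₕ-adjoin⁻ {x} {y} {y′} (subst (y′ ∈ₕ_) (sym eq) (∈ₕ-adjoin-self x′ y′))
... | inj₂ y′∈x = contradiction y′∈x y′∉x
... | inj₁ refl = +-cancelʳ-≡ (2 ^ y) x x′ x+2^y≡x′+2^y , refl
  where
  x+2^y≡x′+2^y : x + 2 ^ y ≡ x′ + 2 ^ y
  x+2^y≡x′+2^y = trans (sym (adjoin-∉ₕ x y y∉x)) (trans eq (adjoin-∉ₕ x′ y y∉x′))

A-suc : ∀ n → A (suc n) ≡ emptyHF ∷ cartesianProductWith adjoin (A n) (A n)
A-suc n = cong (emptyHF ∷_) (concatMap-map≡cartesianProductWith adjoin (A n) (A n))

∅∈A : ∀ n → emptyHF ∈ A n
∅∈A zero    = here refl
∅∈A (suc n) = here refl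

adjoin∈A-suc : ∀ n {x y} → x ∈ A n → y ∈ A n → adjoin x y ∈ A (suc n)
adjoin∈A-suc n {x} {y} x∈A y∈A =
  subst (adjoin x y ∈_) (sym (A-suc n)) (there (∈-cartesianProductWith⁺ adjoin x∈A y∈A))

∈A-suc⁻ : ∀ n {s} → s ∈ A (suc n) →
          s ≡ emptyHF ⊎ ∃₂ λ x y → x ∈ A n × y ∈ A n × s ≡ adjoin x y
∈A-suc⁻ n {s} s∈A with subst (s ∈_) (A-suc n) s∈A
... | here s≡∅  = inj₁ s≡∅
... | there s∈× = inj₂ (∈-cartesianProductWith⁻ adjoin (A n) (A n) s∈×)

A-mono : ∀ n → A n ⊆ A (suc n)
A-mono zero    (here refl) = here refl
A-mono (suc n) s∈A with ∈A-suc⁻ n s∈A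
... | inj₁ refl                       = here refl
... | inj₂ (x , y , x∈A , y∈A , refl) = adjoin∈A-suc (suc n) (A-mono n x∈A) (A-mono n y∈A)

Aprev⊆A : ∀ n → Aprev n ⊆ A n
Aprev⊆A zero    ()
Aprev⊆A (suc n) = A-mono n

adjoin∈A : ∀ n {x y} → x ∈ Aprev n → y ∈ Aprev n → adjoin x y ∈ A n
adjoin∈A zero    ()
adjoin∈A (suc n) = adjoin∈A-suc n

∈ₕ-A⇒∈Aprev : ∀ n {s z} → s ∈ A n → z ∈ₕ s → z ∈ Aprev n
∈ₕ-A⇒∈Aprev zero    {z = z} (here refl) z∈∅ = contradiction z∈∅ (∉ₕ-∅ z)
∈ₕ-A⇒∈Aprev (suc n) {z = z} s∈A z∈s with ∈A-suc⁻ n s∈A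
... | inj₁ refl = contradiction z∈s (∉ₕ-∅ z)
... | inj₂ (x , y , x∈A , y∈A , refl) with ∈ₕ-adjoin⁻ {x} {y} {z} z∈s
...   | inj₁ refl = y∈A
...   | inj₂ z∈x  = Aprev⊆A n (∈ₕ-A⇒∈Aprev n x∈A z∈x)

New : ℕ → List ℕ
New n = filter (λ z → ¬? (z ∈? Aprev n)) (A n)

∈New⁺ : ∀ n {z} → z ∈ A n → z ∉ Aprev n → z ∈ New n
∈New⁺ n = ∈-filter⁺ (λ z → ¬? (z ∈? Aprev n))

∈New⁻ : ∀ n {z} → z ∈ New n → z ∈ A n × z ∉ Aprev n
∈New⁻ n = ∈-filter⁻ (λ z → ¬? (z ∈? Aprev n))

New∉ₕA : ∀ n {x y} → x ∈ A n → y ∈ New n → y ∉ₕ x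
New∉ₕA n x∈A y∈New y∈x = proj₂ (∈New⁻ n y∈New) (∈ₕ-A⇒∈Aprev n x∈A y∈x)

adjoin∈New : ∀ n {x y} → x ∈ A n → y ∈ New n → adjoin x y ∈ New (suc n)
adjoin∈New n {x} {y} x∈A y∈New = ∈New⁺ (suc n) (adjoin∈A-suc n x∈A (proj₁ (∈New⁻ n y∈New)))
  λ xy∈A → proj₂ (∈New⁻ n y∈New) (∈ₕ-A⇒∈Aprev n xy∈A (∈ₕ-adjoin-self x y))

c*c≤c-suc : ∀ n → c n * c n ≤ c (suc n)
c*c≤c-suc n = begin
  c n * c n                    ≡⟨ length-cartesianProductWith _,_ N N ⟨
  length pairs                 ≡⟨ length-map (uncurry adjoin) pairs ⟨
  length (map (uncurry adjoin) pairs)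
    ≤⟨ length≤card (Unique-map⁺-on (uncurry adjoin) adjoin-injective-on-pairs N×N!) image⊆New ⟩
  c (suc n)                    ∎
  where
  open ≤-Reasoning
  N : List ℕ
  N = deduplicate _≟_ (New n)

  pairs : List (ℕ × ℕ)
  pairs = cartesianProduct N N

  N×N! : Unique pairs
  N×N! = cartesianProduct⁺ (deduplicate-! (New n)) (deduplicate-! (New n))

  ∈pairs⁻ : ∀ {x y} → (x , y) ∈ pairs → x ∈ A n × y ∈ New n
  ∈pairs⁻ xy∈pairs with ∈-cartesianProduct⁻ N N xy∈pairs
  ... | x∈N , y∈N = proj₁ (∈New⁻ n (∈-deduplicate⁻ _≟_ (New n) x∈N)) , ∈-deduplicate⁻ _≟_ (New n) y∈N

  adjoin-injective-on-pairs : ∀ {p q} → p ∈ pairs → q ∈ pairs →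
                              uncurry adjoin p ≡ uncurry adjoin q → p ≡ q
  adjoin-injective-on-pairs {x , y} {x′ , y′} p∈pairs q∈pairs eq
    with ∈pairs⁻ p∈pairs | ∈pairs⁻ q∈pairs
  ... | x∈A , y∈New | x′∈A , y′∈New
    with adjoin-injective (New∉ₕA n x∈A y∈New) (New∉ₕA n x′∈A y∈New) (New∉ₕA n x∈A y′∈New) eq
  ... | x≡x′ , y≡y′ = cong₂ _,_ x≡x′ y≡y′

  image⊆New : map (uncurry adjoin) pairs ⊆ New (suc n)
  image⊆New s∈image with ∈-map⁻ (uncurry adjoin) s∈image
  ... | (x , y) , xy∈pairs , refl with ∈pairs⁻ xy∈pairs
  ...   | x∈A , y∈New = adjoin∈New n x∈A y∈New

c-suc≤c*c+c*card-Aprev+card-Aprev*c : ∀ n →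
  c (suc n) ≤ c n * c n + (c n * card (Aprev n) + card (Aprev n) * c n)
c-suc≤c*c+c*card-Aprev+card-Aprev*c n = begin
  c (suc n)       ≤⟨ card≤length New⊆products ⟩
  length products ≡⟨ length-++ (N ⊗ N) ⟩
  length (N ⊗ N) + length (N ⊗ O ++ O ⊗ N)
    ≡⟨ cong (length (N ⊗ N) +_) (length-++ (N ⊗ O)) ⟩
  length (N ⊗ N) + (length (N ⊗ O) + length (O ⊗ N))
    ≡⟨ cong₂ _+_ (length-cartesianProductWith adjoin N N)
                 (cong₂ _+_ (length-cartesianProductWith adjoin N O) (length-cartesianProductWith adjoin O N)) ⟩
  c n * c n + (c n * card (Aprev n) + card (Aprev n) * c n) ∎
  where
  open ≤-Reasoning
  N O : List ℕ
  N = deduplicate _≟_ (New n)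
  O = deduplicate _≟_ (Aprev n)

  _⊗_ : List ℕ → List ℕ → List ℕ
  _⊗_ = cartesianProductWith adjoin

  products : List ℕ
  products = N ⊗ N ++ N ⊗ O ++ O ⊗ N

  new : ∀ {x} → x ∈ A n → x ∉ Aprev n → x ∈ N
  new x∈A x∉O = ∈-deduplicate⁺ _≟_ (∈New⁺ n x∈A x∉O)

  old : ∀ {x} → x ∈ Aprev n → x ∈ O
  old = ∈-deduplicate⁺ _≟_

  New⊆products : New (suc n) ⊆ products
  New⊆products s∈New with ∈New⁻ (suc n) s∈New
  ... | s∈A , s∉A with ∈A-suc⁻ n s∈A
  ...   | inj₁ refl = contradiction (∅∈A n) s∉A
  ...   | inj₂ (x , y , x∈A , y∈A , refl) with x ∈? Aprev n | y ∈? Aprev n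
  ...     | yes x∈O | yes y∈O = contradiction (adjoin∈A n x∈O y∈O) s∉A
  ...     | no  x∉O | no  y∉O = ∈-++⁺ˡ (∈-cartesianProductWith⁺ adjoin (new x∈A x∉O) (new y∈A y∉O))
  ...     | no  x∉O | yes y∈O =
    ∈-++⁺ʳ (N ⊗ N) (∈-++⁺ˡ (∈-cartesianProductWith⁺ adjoin (new x∈A x∉O) (old y∈O)))
  ...     | yes x∈O | no  y∉O =
    ∈-++⁺ʳ (N ⊗ N) (∈-++⁺ʳ (N ⊗ O) (∈-cartesianProductWith⁺ adjoin (old x∈O) (new y∈A y∉O)))

card-A≤card-Aprev+c : ∀ n → card (A n) ≤ card (Aprev n) + c n
card-A≤card-Aprev+c n =
  ≤-trans (card≤length A⊆old++new) (≤-reflexive (length-++ (deduplicate _≟_ (Aprev n))))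
  where
  A⊆old++new : A n ⊆ deduplicate _≟_ (Aprev n) ++ deduplicate _≟_ (New n)
  A⊆old++new {z} z∈A with z ∈? Aprev n
  ... | yes z∈O = ∈-++⁺ˡ (∈-deduplicate⁺ _≟_ z∈O)
  ... | no  z∉O = ∈-++⁺ʳ (deduplicate _≟_ (Aprev n)) (∈-deduplicate⁺ _≟_ (∈New⁺ n z∈A z∉O))

2*c≤c-suc : ∀ n → 2 ≤ c n → 2 * c n ≤ c (suc n)
2*c≤c-suc n 2≤cn = ≤-trans (*-monoˡ-≤ (c n) 2≤cn) (c*c≤c-suc n)

2≤c : ∀ n → 2 ≤ c (2 + n)
2≤c zero    = ≤-refl
2≤c (suc n) = ≤-trans (2≤c n) (≤-trans (m≤m+n C (C + 0)) (2*c≤c-suc (2 + n) (2≤c n)))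
  where
  C : ℕ
  C = c (2 + n)

card-Aprev≤c : ∀ n → card (Aprev n) ≤ c n
card-Aprev≤c 0 = z≤n
card-Aprev≤c 1 = ≤-refl
card-Aprev≤c 2 = ≤-refl
card-Aprev≤c (suc (suc (suc n))) = begin
  card (A (2 + n))     ≤⟨ card-A≤card-Aprev+c (2 + n) ⟩
  card (A (1 + n)) + C ≤⟨ +-monoˡ-≤ C (card-Aprev≤c (suc (suc n))) ⟩
  C + C                ≡⟨ cong (C +_) (+-identityʳ C) ⟨
  2 * C                ≤⟨ 2*c≤c-suc (2 + n) (2≤c n) ⟩
  c (3 + n)            ∎
  where
  open ≤-Reasoning
  C : ℕ
  C = c (2 + n)

c*card-A≤2*c-suc : ∀ n → c n * card (A n) ≤ 2 * c (suc n)
c*card-A≤2*c-suc n = begin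
  c n * card (A n)          ≤⟨ *-monoʳ-≤ (c n) card-A≤c+c ⟩
  c n * (c n + c n)         ≡⟨ *-distribˡ-+ (c n) (c n) (c n) ⟩
  c n * c n + c n * c n     ≤⟨ +-mono-≤ (c*c≤c-suc n) (c*c≤c-suc n) ⟩
  c (suc n) + c (suc n)     ≡⟨ cong (c (suc n) +_) (+-identityʳ (c (suc n))) ⟨
  2 * c (suc n)             ∎
  where
  open ≤-Reasoning
  card-A≤c+c : card (A n) ≤ c n + c n
  card-A≤c+c = ≤-trans (card-A≤card-Aprev+c n) (+-monoˡ-≤ (c n) (card-Aprev≤c n))

lemma2 : (n : ℕ) → 2 ≤ n →
    (c (n ∸ 1) ^ 2 ≤ c n)
    × (c (n ∸ 2) * c n ≤ c (n ∸ 1) ^ 2 * (c (n ∸ 2) + 4))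
lemma2 (suc zero)    (s≤s ())
lemma2 (suc (suc n)) _ = lower , upper
  where
  open ≤-Reasoning
  C a : ℕ
  C = c (suc n)
  a = card (A n)

  C^2≡C*C : C ^ 2 ≡ C * C
  C^2≡C*C = cong (C *_) (*-identityʳ C)

  lower : C ^ 2 ≤ c (2 + n)
  lower = subst (_≤ c (2 + n)) (sym C^2≡C*C) (c*c≤c-suc (suc n))

  regroup : ∀ p q r → p * (q * q + (q * r + r * q)) ≡ p * (q * q) + 2 * q * (p * r)
  regroup = solve-∀

  collect : ∀ p q → p * (q * q) + 2 * q * (2 * q) ≡ q * q * (p + 4)
  collect = solve-∀

  upper : c n * c (2 + n) ≤ C ^ 2 * (c n + 4)
  upper = begin
    c n * c (2 + n)
      ≤⟨ *-monoʳ-≤ (c n) (c-suc≤c*c+c*card-Aprev+card-Aprev*c (suc n)) ⟩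
    c n * (C * C + (C * a + a * C))
      ≡⟨ regroup (c n) C a ⟩
    c n * (C * C) + 2 * C * (c n * a)
      ≤⟨ +-monoʳ-≤ (c n * (C * C)) (*-monoʳ-≤ (2 * C) (c*card-A≤2*c-suc n)) ⟩
    c n * (C * C) + 2 * C * (2 * C)
      ≡⟨ collect (c n) C ⟩
    C * C * (c n + 4)
      ≡⟨ cong (_* (c n + 4)) C^2≡C*C ⟨
    C ^ 2 * (c n + 4)
      ∎
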